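{- $\mathbf{V}$-terms normalize to $\mathbf{IPC}$-terms: if $\Gamma\vdash_{\mathbf{V}} t:A$, then there is a term $t'$ containing no $\mathtt{V}_n$ constructor such that $t\to_{\mathbf{V}}^* t'$, $t'$ is in normal form, and $\Gamma\vdash_{\mathbf{IPC}} t':A$.
   Context: Formulas are built from propositional atoms and $\bot$ using $\to,\land,\lor$. Terms of $\mathbf{V}$: $t,s,u ::= x \mid t\,s \mid \lambda x.t \mid \mathtt{efq}(t) \mid \langle t,s\rangle \mid \pi_i t \mid \mathtt{in}_i t \mid \mathtt{case}\ t\ [y.s_1]\ [y.s_2] \mid \mathtt{V}_n(\vec x.t,\ y.s_1,\ y.s_2,\ z.\vec u)$ ($i\in\{1,2\}$, $n\ge 1$), where in $\mathtt{V}_n$ the variables $\vec x=x_1,\dots,x_n$ are bound in $t$, $y$ in $s_1,s_2$, $z$ in each of $\vec u=u_1,\dots,u_n$; terms are up to $\alpha$-equivalence, $t\{x:=s\}$ is capture-avoiding substitution. $\mathbf{IPC}$-terms are those without $\mathtt{V}_n$. Notation: $\lambda\vec x.t:=\lambda x_1.\cdots\lambda x_n.t$ and $(B_i\to C_i)_{i=1\dots n}\to E := (B_1\to C_1)\to(\cdots\to((B_n\to C_n)\to E))$. $\Gamma\vdash_{\mathbf{IPC}} t:A$ is derivability with the standard natural-deduction typing rules of intuitionistic propositional logic: axiom for variables in $\Gamma$; $\lambda$ for $\to_I$; application for $\to_E$; pairs for $\land_I$; $\pi_i t:A_i$ from $t:A_1\land A_2$; $\mathtt{in}_i t: A_1\lor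 A_2$ from $t:A_i$; $\mathtt{case}\,t\,[y.s_1][y.s_2]:D$ from $\Gamma\vdash t:A_1\lor A_2$ and $\Gamma,y:A_i\vdash s_i:D$; $\mathtt{efq}(t):A$ from $t:\bot$. $\vdash_{\mathbf{V}}$ adds the rule Visser$_n$: from $x_1:B_1\to C_1,\dots,x_n:B_n\to C_n\vdash t:A_1\lor A_2$ (exactly these assumptions), $\Gamma,y:(B_i\to C_i)_{i}\to A_1\vdash s_1:D$, $\Gamma,y:(B_i\to C_i)_{i}\to A_2\vdash s_2:D$, and $\Gamma,z:(B_i\to C_i)_{i}\to B_j\vdash u_j:D$ for each $j=1,\dots,n$, infer $\Gamma\vdash \mathtt{V}_n(\vec x.t,y.s_1,y.s_2,z.\vec u):D$. Weak head contexts: $W::=\Box\mid W\,t\mid \pi_i W\mid \mathtt{case}\ W\ [y.s_1]\ [y.s_2]$, with $W\langle t\rangle$ filling the hole by $t$. Top-level reductions: $(\lambda x.t)s\mapsto t\{x:=s\}$; $\pi_i\langle t_1,t_2\rangle\mapsto t_i$; $\mathtt{case}\,(\mathtt{in}_i t)\,[y.s_1][y.s_2]\mapsto s_i\{y:=t\}$; $\mathtt{V}_n(\vec x.\mathtt{in}_i t, y.s_1,y.s_2,z.\vec u)\mapsto s_i\{y:=\lambda\vec x.t\}$; $\mathtt{V}_n(\vec x.W\langle\mathtt{efq}(t)\rangle, y.s_1,y.s_2,z.\vec u)\mapsto s_1\{y:=\lambda\vec x.\mathtt{efq}(t)\}$; $\mathtt{V}_n(\vec x.W\langle x_j\,t\rangle,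 y.s_1,y.s_2,z.\vec u)\mapsto u_j\{z:=\lambda\vec x.t\}$. $\to_{\mathbf{V}}$ is the closure of these under all term constructors; normal form means no $\to_{\mathbf{V}}$ step applies. -}

module Defs where

open import Data.Nat using (ℕ; zero; suc)
open import Data.Fin using (Fin; toℕ; opposite)
open import Data.Vec using (Vec; lookup; toList; zipWith; _[_]≔_) renaming ([] to []ᵛ; _∷_ to _∷ᵛ_)
open import Data.List using (List; []; _∷_; reverse)
open import Data.Product using (Σ; _×_; _,_)
open import Relation.Nullary using (¬_)
open import Relation.Binary.Construct.Closure.ReflexiveTransitive using (Star)

infixr 6 _⇒_
infixr 7 _∨_
infixr 8 _∧_

data Form : Set where
  atom : ℕ → Form
  ⊥'   : Form
  _⇒_  : Form → Form → Form
  _∧_  : Form → Form → Form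
  _∨_  : Form → Form → Form

-- Terms, with de Bruijn indices (so α-equivalence is syntactic identity).
--
-- V n t s₁ s₂ us   represents   V_{n+1}(x₁…x_{n+1}.t, y.s₁, y.s₂, z.us).
--   * t is under n+1 binders, in the order of λx₁.⋯λx_{n+1}.t, i.e.
--     x_{n+1} is index 0 and x₁ is index n inside t;
--     0-based j : Fin (suc n) names x_{j+1} = var (toℕ (opposite j)).
--   * s₁, s₂ and each element of us bind one variable (index 0).
--   * us = u₁ … u_{n+1}  (lookup us j = u_{j+1}).

data Tm : Set where
  var  : ℕ → Tm
  app  : Tm → Tm → Tm
  lam  : Tm → Tm
  efq  : Tm → Tm
  pair : Tm → Tm → Tm
  π₁   : Tm → Tm
  π₂   : Tm → Tm
  in₁  : Tm → Tm
  in₂  : Tm → Tm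
  case : Tm → Tm → Tm → Tm
  V    : (n : ℕ) → Tm → Tm → Tm → Vec Tm (suc n) → Tm

data IPCTerm : Tm → Set where
  var  : ∀ {k} → IPCTerm (var k)
  app  : ∀ {t s} → IPCTerm t → IPCTerm s → IPCTerm (app t s)
  lam  : ∀ {t} → IPCTerm t → IPCTerm (lam t)
  efq  : ∀ {t} → IPCTerm t → IPCTerm (efq t)
  pair : ∀ {t s} → IPCTerm t → IPCTerm s → IPCTerm (pair t s)
  π₁   : ∀ {t} → IPCTerm t → IPCTerm (π₁ t)
  π₂   : ∀ {t} → IPCTerm t → IPCTerm (π₂ t)
  in₁  : ∀ {t} → IPCTerm t → IPCTerm (in₁ t)
  in₂  : ∀ {t} → IPCTerm t → IPCTerm (in₂ t)
  case : ∀ {t s₁ s₂} → IPCTerm t → IPCTerm s₁ → IPCTerm s₂ → IPCTerm (case t s₁ s₂)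

ext : (ℕ → ℕ) → ℕ → ℕ
ext ρ zero    = zero
ext ρ (suc k) = suc (ρ k)

extⁿ : ℕ → (ℕ → ℕ) → ℕ → ℕ
extⁿ zero    ρ = ρ
extⁿ (suc n) ρ = ext (extⁿ n ρ)

mutual
  rename : (ℕ → ℕ) → Tm → Tm
  rename ρ (var k)          = var (ρ k)
  rename ρ (app t s)        = app (rename ρ t) (rename ρ s)
  rename ρ (lam t)          = lam (rename (ext ρ) t)
  rename ρ (efq t)          = efq (rename ρ t)
  rename ρ (pair t s)       = pair (rename ρ t) (rename ρ s)
  rename ρ (π₁ t)           = π₁ (rename ρ t)
  rename ρ (π₂ t)           = π₂ (rename ρ t)
  rename ρ (in₁ t)          = in₁ (rename ρ t)
  rename ρ (in₂ t)          = in₂ (rename ρ t)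
  rename ρ (case t s₁ s₂)   = case (rename ρ t) (rename (ext ρ) s₁) (rename (ext ρ) s₂)
  rename ρ (V n t s₁ s₂ us) =
    V n (rename (extⁿ (suc n) ρ) t) (rename (ext ρ) s₁) (rename (ext ρ) s₂) (renameVec (ext ρ) us)

  renameVec : ∀ {m} → (ℕ → ℕ) → Vec Tm m → Vec Tm m
  renameVec ρ []ᵛ       = []ᵛ
  renameVec ρ (u ∷ᵛ us) = rename ρ u ∷ᵛ renameVec ρ us

exts : (ℕ → Tm) → ℕ → Tm
exts σ zero    = var zero
exts σ (suc k) = rename suc (σ k)

extsⁿ : ℕ → (ℕ → Tm) → ℕ → Tm
extsⁿ zero    σ = σ
extsⁿ (suc n) σ = exts (extsⁿ n σ)

mutual
  subst : (ℕ → Tm) → Tm → Tm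
  subst σ (var k)          = σ k
  subst σ (app t s)        = app (subst σ t) (subst σ s)
  subst σ (lam t)          = lam (subst (exts σ) t)
  subst σ (efq t)          = efq (subst σ t)
  subst σ (pair t s)       = pair (subst σ t) (subst σ s)
  subst σ (π₁ t)           = π₁ (subst σ t)
  subst σ (π₂ t)           = π₂ (subst σ t)
  subst σ (in₁ t)          = in₁ (subst σ t)
  subst σ (in₂ t)          = in₂ (subst σ t)
  subst σ (case t s₁ s₂)   = case (subst σ t) (subst (exts σ) s₁) (subst (exts σ) s₂)
  subst σ (V n t s₁ s₂ us) =
    V n (subst (extsⁿ (suc n) σ) t) (subst (exts σ) s₁) (subst (exts σ) s₂) (substVec (exts σ) us)

  substVec : ∀ {m} → (ℕ → Tm) → Vec Tm m → Vec Tm m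
  substVec σ []ᵛ       = []ᵛ
  substVec σ (u ∷ᵛ us) = subst σ u ∷ᵛ substVec σ us

single : Tm → ℕ → Tm
single s zero    = s
single s (suc k) = var k

_[_] : Tm → Tm → Tm
t [ s ] = subst (single s) t

lams : ℕ → Tm → Tm
lams zero    t = t
lams (suc n) t = lam (lams n t)

data WCtx : Set where
  □     : WCtx
  appW  : WCtx → Tm → WCtx
  π₁W   : WCtx → WCtx
  π₂W   : WCtx → WCtx
  caseW : WCtx → Tm → Tm → WCtx

plug : WCtx → Tm → Tm
plug □               t = t
plug (appW W s)      t = app (plug W t) s
plug (π₁W W)         t = π₁ (plug W t)
plug (π₂W W)         t = π₂ (plug W t)
plug (caseW W s₁ s₂) t = case (plug W t) s₁ s₂

infix 4 _↦_ _→V_ _→V*_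

data _↦_ : Tm → Tm → Set where
  β     : ∀ {t s} → app (lam t) s ↦ t [ s ]
  π₁β   : ∀ {t₁ t₂} → π₁ (pair t₁ t₂) ↦ t₁
  π₂β   : ∀ {t₁ t₂} → π₂ (pair t₁ t₂) ↦ t₂
  case₁ : ∀ {t s₁ s₂} → case (in₁ t) s₁ s₂ ↦ s₁ [ t ]
  case₂ : ∀ {t s₁ s₂} → case (in₂ t) s₁ s₂ ↦ s₂ [ t ]
  V-in₁ : ∀ {n t s₁ s₂ us} → V n (in₁ t) s₁ s₂ us ↦ s₁ [ lams (suc n) t ]
  V-in₂ : ∀ {n t s₁ s₂ us} → V n (in₂ t) s₁ s₂ us ↦ s₂ [ lams (suc n) t ]
  V-efq : ∀ {n W t s₁ s₂ us} →
          V n (plug W (efq t)) s₁ s₂ us ↦ s₁ [ lams (suc n) (efq t) ]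
  V-hyp : ∀ {n W t s₁ s₂ us} (j : Fin (suc n)) →
          V n (plug W (app (var (toℕ (opposite j))) t)) s₁ s₂ us
            ↦ lookup us j [ lams (suc n) t ]

data _→V_ : Tm → Tm → Set where
  top   : ∀ {t t'} → t ↦ t' → t →V t'
  appL  : ∀ {t t' s} → t →V t' → app t s →V app t' s
  appR  : ∀ {t s s'} → s →V s' → app t s →V app t s'
  lamC  : ∀ {t t'} → t →V t' → lam t →V lam t'
  efqC  : ∀ {t t'} → t →V t' → efq t →V efq t'
  pairL : ∀ {t t' s} → t →V t' → pair t s →V pair t' s
  pairR : ∀ {t s s'} → s →V s' → pair t s →V pair t s'
  π₁C   : ∀ {t t'} → t →V t' → π₁ t →V π₁ t'
  π₂C   : ∀ {t t'} → t →V t' → π₂ t →V π₂ t'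
  in₁C  : ∀ {t t'} → t →V t' → in₁ t →V in₁ t'
  in₂C  : ∀ {t t'} → t →V t' → in₂ t →V in₂ t'
  caseC : ∀ {t t' s₁ s₂} → t →V t' → case t s₁ s₂ →V case t' s₁ s₂
  case₁C : ∀ {t s₁ s₁' s₂} → s₁ →V s₁' → case t s₁ s₂ →V case t s₁' s₂
  case₂C : ∀ {t s₁ s₂ s₂'} → s₂ →V s₂' → case t s₁ s₂ →V case t s₁ s₂'
  VtC   : ∀ {n t t' s₁ s₂ us} → t →V t' → V n t s₁ s₂ us →V V n t' s₁ s₂ us
  Vs₁C  : ∀ {n t s₁ s₁' s₂ us} → s₁ →V s₁' → V n t s₁ s₂ us →V V n t s₁' s₂ us
  Vs₂C  : ∀ {n t s₁ s₂ s₂' us} → s₂ →V s₂' → V n t s₁ s₂ us →V V n t s₁ s₂' us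
  VuC   : ∀ {n t s₁ s₂ us u'} (j : Fin (suc n)) → lookup us j →V u' →
          V n t s₁ s₂ us →V V n t s₁ s₂ (us [ j ]≔ u')

_→V*_ : Tm → Tm → Set
_→V*_ = Star _→V_

Normal : Tm → Set
Normal t = ∀ t' → ¬ (t →V t')

Ctx : Set
Ctx = List Form

infix 4 _∋_∶_ _⊢V_∶_ _⊢IPC_∶_

data _∋_∶_ : Ctx → ℕ → Form → Set where
  here  : ∀ {Γ A} → (A ∷ Γ) ∋ zero ∶ A
  there : ∀ {Γ A B k} → Γ ∋ k ∶ A → (B ∷ Γ) ∋ suc k ∶ A

chain : ∀ {m} → Vec Form m → Vec Form m → Form → Form
chain []ᵛ       []ᵛ       E = E
chain (B ∷ᵛ Bs) (C ∷ᵛ Cs) E = (B ⇒ C) ⇒ chain Bs Cs E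

-- the context  x₁ : B₁ → C₁, …, xₘ : Bₘ → Cₘ  (xₘ is de Bruijn index 0)
hyps : ∀ {m} → Vec Form m → Vec Form m → Ctx
hyps Bs Cs = reverse (toList (zipWith _⇒_ Bs Cs))

data _⊢IPC_∶_ : Ctx → Tm → Form → Set where
  ax   : ∀ {Γ k A} → Γ ∋ k ∶ A → Γ ⊢IPC var k ∶ A
  ⇒I   : ∀ {Γ t A B} → (A ∷ Γ) ⊢IPC t ∶ B → Γ ⊢IPC lam t ∶ A ⇒ B
  ⇒E   : ∀ {Γ t s A B} → Γ ⊢IPC t ∶ A ⇒ B → Γ ⊢IPC s ∶ A → Γ ⊢IPC app t s ∶ B
  ∧I   : ∀ {Γ t s A B} → Γ ⊢IPC t ∶ A → Γ ⊢IPC s ∶ B → Γ ⊢IPC pair t s ∶ A ∧ B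
  ∧E₁  : ∀ {Γ t A B} → Γ ⊢IPC t ∶ A ∧ B → Γ ⊢IPC π₁ t ∶ A
  ∧E₂  : ∀ {Γ t A B} → Γ ⊢IPC t ∶ A ∧ B → Γ ⊢IPC π₂ t ∶ B
  ∨I₁  : ∀ {Γ t A B} → Γ ⊢IPC t ∶ A → Γ ⊢IPC in₁ t ∶ A ∨ B
  ∨I₂  : ∀ {Γ t A B} → Γ ⊢IPC t ∶ B → Γ ⊢IPC in₂ t ∶ A ∨ B
  ∨E   : ∀ {Γ t s₁ s₂ A B D} → Γ ⊢IPC t ∶ A ∨ B →
         (A ∷ Γ) ⊢IPC s₁ ∶ D → (B ∷ Γ) ⊢IPC s₂ ∶ D → Γ ⊢IPC case t s₁ s₂ ∶ D
  ⊥E   : ∀ {Γ t A} → Γ ⊢IPC t ∶ ⊥' → Γ ⊢IPC efq t ∶ A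

data _⊢V_∶_ : Ctx → Tm → Form → Set where
  ax   : ∀ {Γ k A} → Γ ∋ k ∶ A → Γ ⊢V var k ∶ A
  ⇒I   : ∀ {Γ t A B} → (A ∷ Γ) ⊢V t ∶ B → Γ ⊢V lam t ∶ A ⇒ B
  ⇒E   : ∀ {Γ t s A B} → Γ ⊢V t ∶ A ⇒ B → Γ ⊢V s ∶ A → Γ ⊢V app t s ∶ B
  ∧I   : ∀ {Γ t s A B} → Γ ⊢V t ∶ A → Γ ⊢V s ∶ B → Γ ⊢V pair t s ∶ A ∧ B
  ∧E₁  : ∀ {Γ t A B} → Γ ⊢V t ∶ A ∧ B → Γ ⊢V π₁ t ∶ A
  ∧E₂  : ∀ {Γ t A B} → Γ ⊢V t ∶ A ∧ B → Γ ⊢V π₂ t ∶ B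
  ∨I₁  : ∀ {Γ t A B} → Γ ⊢V t ∶ A → Γ ⊢V in₁ t ∶ A ∨ B
  ∨I₂  : ∀ {Γ t A B} → Γ ⊢V t ∶ B → Γ ⊢V in₂ t ∶ A ∨ B
  ∨E   : ∀ {Γ t s₁ s₂ A B D} → Γ ⊢V t ∶ A ∨ B →
         (A ∷ Γ) ⊢V s₁ ∶ D → (B ∷ Γ) ⊢V s₂ ∶ D → Γ ⊢V case t s₁ s₂ ∶ D
  ⊥E   : ∀ {Γ t A} → Γ ⊢V t ∶ ⊥' → Γ ⊢V efq t ∶ A
  visser : ∀ {Γ n t s₁ s₂ us A₁ A₂ D} (Bs Cs : Vec Form (suc n)) →
           hyps Bs Cs ⊢V t ∶ A₁ ∨ A₂ →
           (chain Bs Cs A₁ ∷ Γ) ⊢V s₁ ∶ D →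
           (chain Bs Cs A₂ ∷ Γ) ⊢V s₂ ∶ D →
           (∀ (j : Fin (suc n)) → (chain Bs Cs (lookup Bs j) ∷ Γ) ⊢V lookup us j ∶ D) →
           Γ ⊢V V n t s₁ s₂ us ∶ D

module Submission where

-- Every derivation Γ ⊢V t ∶ A is turned, by induction on the derivation,
-- into a reduction t →V* t' with Γ ⊢IPC t' ∶ A (`eliminate`).  All rules
-- except Visser are congruences.  For a Visser term V(x⃗.t, y.s₁, y.s₂, z.u⃗)
-- the induction hypothesis makes the major premise t an IPC proof of A₁ ∨ A₂
-- from the hypotheses x⃗ : B⃗ → C⃗; we normalise it.  A normal proof of a
-- disjunction is an injection inᵢ, or a neutral term whose head is efq or an
-- application xⱼ u of a hypothesis, sitting under a weak head context
-- (`classify`).  In each case one top-level V-rule fires, and its contractum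
-- is IPC-typable because λx⃗.u proves the formula (B⃗ → C⃗) → E the branch
-- expects (`discharge`).  A final IPC normalisation yields the theorem.

open import Defs
open import Data.Product using (Σ; _×_; _,_; proj₁; proj₂)
open import Data.Nat using (ℕ; zero; suc; _+_)
open import Data.Nat.Properties using (+-identityʳ; +-suc)
open import Data.Fin using (Fin; toℕ; opposite) renaming (zero to fz; suc to fs)
open import Data.Fin.Properties using (opposite-suc; toℕ-fromℕ)
open import Data.Vec using (Vec; lookup; toList; zipWith; _[_]≔_) renaming ([] to []ᵛ; _∷_ to _∷ᵛ_)
open import Data.Vec.Properties using ([]≔-idempotent; []≔-lookup; lookup∘update)
open import Data.List using ([]; _∷_; _++_)
open import Data.List.Properties using (ʳ++-defn; ++-identityʳ)
open import Data.Sum using (_⊎_; inj₁; inj₂)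
open import Function using (_∘_; id)
open import Relation.Binary.PropositionalEquality
  using (_≡_; refl; sym; trans; cong; cong₂; _≗_; module ≡-Reasoning)
  renaming (subst to transport)
open import Relation.Binary.Construct.Closure.ReflexiveTransitive using (Star; ε; _◅_; _◅◅_; gmap)

cong₃ : ∀ {A B C D : Set} (f : A → B → C → D) {a a' b b' c c'} →
        a ≡ a' → b ≡ b' → c ≡ c' → f a b c ≡ f a' b' c'
cong₃ f refl refl refl = refl

cong₄ : ∀ {A B C D E : Set} (f : A → B → C → D → E) {a a' b b' c c' d d'} →
        a ≡ a' → b ≡ b' → c ≡ c' → d ≡ d' → f a b c d ≡ f a' b' c' d'
cong₄ f refl refl refl refl = refl

exts-cong : ∀ {σ σ'} → σ ≗ σ' → exts σ ≗ exts σ'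
exts-cong h zero    = refl
exts-cong h (suc k) = cong (rename suc) (h k)

extsⁿ-cong : ∀ n {σ σ'} → σ ≗ σ' → extsⁿ n σ ≗ extsⁿ n σ'
extsⁿ-cong zero    h = h
extsⁿ-cong (suc n) h = exts-cong (extsⁿ-cong n h)

mutual
  subst-cong : ∀ {σ σ'} → σ ≗ σ' → ∀ t → subst σ t ≡ subst σ' t
  subst-cong h (var k)          = h k
  subst-cong h (app t s)        = cong₂ app (subst-cong h t) (subst-cong h s)
  subst-cong h (lam t)          = cong lam (subst-cong (exts-cong h) t)
  subst-cong h (efq t)          = cong efq (subst-cong h t)
  subst-cong h (pair t s)       = cong₂ pair (subst-cong h t) (subst-cong h s)
  subst-cong h (π₁ t)           = cong π₁ (subst-cong h t)
  subst-cong h (π₂ t)           = cong π₂ (subst-cong h t)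
  subst-cong h (in₁ t)          = cong in₁ (subst-cong h t)
  subst-cong h (in₂ t)          = cong in₂ (subst-cong h t)
  subst-cong h (case t s₁ s₂)   =
    cong₃ case (subst-cong h t) (subst-cong (exts-cong h) s₁) (subst-cong (exts-cong h) s₂)
  subst-cong h (V n t s₁ s₂ us) =
    cong₄ (V n) (subst-cong (extsⁿ-cong (suc n) h) t)
      (subst-cong (exts-cong h) s₁) (subst-cong (exts-cong h) s₂) (substVec-cong (exts-cong h) us)

  substVec-cong : ∀ {m σ σ'} → σ ≗ σ' → (us : Vec Tm m) → substVec σ us ≡ substVec σ' us
  substVec-cong h []ᵛ       = refl
  substVec-cong h (u ∷ᵛ us) = cong₂ _∷ᵛ_ (subst-cong h u) (substVec-cong h us)

exts-var : ∀ {σ} → σ ≗ var → exts σ ≗ var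
exts-var h zero    = refl
exts-var h (suc k) = cong (rename suc) (h k)

extsⁿ-var : ∀ n {σ} → σ ≗ var → extsⁿ n σ ≗ var
extsⁿ-var zero    h = h
extsⁿ-var (suc n) h = exts-var (extsⁿ-var n h)

mutual
  subst-id : ∀ {σ} → σ ≗ var → ∀ t → subst σ t ≡ t
  subst-id h (var k)          = h k
  subst-id h (app t s)        = cong₂ app (subst-id h t) (subst-id h s)
  subst-id h (lam t)          = cong lam (subst-id (exts-var h) t)
  subst-id h (efq t)          = cong efq (subst-id h t)
  subst-id h (pair t s)       = cong₂ pair (subst-id h t) (subst-id h s)
  subst-id h (π₁ t)           = cong π₁ (subst-id h t)
  subst-id h (π₂ t)           = cong π₂ (subst-id h t)
  subst-id h (in₁ t)          = cong in₁ (subst-id h t)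
  subst-id h (in₂ t)          = cong in₂ (subst-id h t)
  subst-id h (case t s₁ s₂)   =
    cong₃ case (subst-id h t) (subst-id (exts-var h) s₁) (subst-id (exts-var h) s₂)
  subst-id h (V n t s₁ s₂ us) =
    cong₄ (V n) (subst-id (extsⁿ-var (suc n) h) t)
      (subst-id (exts-var h) s₁) (subst-id (exts-var h) s₂) (substVec-id (exts-var h) us)

  substVec-id : ∀ {m σ} → σ ≗ var → (us : Vec Tm m) → substVec σ us ≡ us
  substVec-id h []ᵛ       = refl
  substVec-id h (u ∷ᵛ us) = cong₂ _∷ᵛ_ (subst-id h u) (substVec-id h us)

exts-ren : ∀ {ρ} → exts (var ∘ ρ) ≗ (var ∘ ext ρ)
exts-ren zero    = refl
exts-ren (suc k) = refl

extsⁿ-ren : ∀ n {ρ} → extsⁿ n (var ∘ ρ) ≗ (var ∘ extⁿ n ρ)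
extsⁿ-ren zero    k = refl
extsⁿ-ren (suc n) {ρ} k = trans (exts-cong (extsⁿ-ren n) k) (exts-ren {extⁿ n ρ} k)

mutual
  rename-as-subst : ∀ ρ t → rename ρ t ≡ subst (var ∘ ρ) t
  rename-as-subst ρ (var k)          = refl
  rename-as-subst ρ (app t s)        = cong₂ app (rename-as-subst ρ t) (rename-as-subst ρ s)
  rename-as-subst ρ (lam t)          = cong lam (trans (rename-as-subst _ t) (sym (subst-cong exts-ren t)))
  rename-as-subst ρ (efq t)          = cong efq (rename-as-subst ρ t)
  rename-as-subst ρ (pair t s)       = cong₂ pair (rename-as-subst ρ t) (rename-as-subst ρ s)
  rename-as-subst ρ (π₁ t)           = cong π₁ (rename-as-subst ρ t)
  rename-as-subst ρ (π₂ t)           = cong π₂ (rename-as-subst ρ t)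
  rename-as-subst ρ (in₁ t)          = cong in₁ (rename-as-subst ρ t)
  rename-as-subst ρ (in₂ t)          = cong in₂ (rename-as-subst ρ t)
  rename-as-subst ρ (case t s₁ s₂)   = cong₃ case (rename-as-subst ρ t)
    (trans (rename-as-subst _ s₁) (sym (subst-cong exts-ren s₁)))
    (trans (rename-as-subst _ s₂) (sym (subst-cong exts-ren s₂)))
  rename-as-subst ρ (V n t s₁ s₂ us) = cong₄ (V n)
    (trans (rename-as-subst _ t) (sym (subst-cong (extsⁿ-ren (suc n)) t)))
    (trans (rename-as-subst _ s₁) (sym (subst-cong exts-ren s₁)))
    (trans (rename-as-subst _ s₂) (sym (subst-cong exts-ren s₂)))
    (trans (renameVec-as-subst _ us) (sym (substVec-cong exts-ren us)))

  renameVec-as-subst : ∀ {m} ρ (us : Vec Tm m) → renameVec ρ us ≡ substVec (var ∘ ρ) us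
  renameVec-as-subst ρ []ᵛ       = refl
  renameVec-as-subst ρ (u ∷ᵛ us) = cong₂ _∷ᵛ_ (rename-as-subst ρ u) (renameVec-as-subst ρ us)

rename-id : ∀ t → rename id t ≡ t
rename-id t = trans (rename-as-subst id t) (subst-id (λ _ → refl) t)

exts-ext : ∀ {σ ρ} → (exts σ ∘ ext ρ) ≗ exts (σ ∘ ρ)
exts-ext zero    = refl
exts-ext (suc k) = refl

extsⁿ-extⁿ : ∀ n {σ ρ} → (extsⁿ n σ ∘ extⁿ n ρ) ≗ extsⁿ n (σ ∘ ρ)
extsⁿ-extⁿ zero    k = refl
extsⁿ-extⁿ (suc n) {σ} {ρ} k = trans (exts-ext {extsⁿ n σ} {extⁿ n ρ} k) (exts-cong (extsⁿ-extⁿ n) k)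

mutual
  subst-rename : ∀ σ ρ t → subst σ (rename ρ t) ≡ subst (σ ∘ ρ) t
  subst-rename σ ρ (var k)          = refl
  subst-rename σ ρ (app t s)        = cong₂ app (subst-rename σ ρ t) (subst-rename σ ρ s)
  subst-rename σ ρ (lam t)          = cong lam (trans (subst-rename _ _ t) (subst-cong exts-ext t))
  subst-rename σ ρ (efq t)          = cong efq (subst-rename σ ρ t)
  subst-rename σ ρ (pair t s)       = cong₂ pair (subst-rename σ ρ t) (subst-rename σ ρ s)
  subst-rename σ ρ (π₁ t)           = cong π₁ (subst-rename σ ρ t)
  subst-rename σ ρ (π₂ t)           = cong π₂ (subst-rename σ ρ t)
  subst-rename σ ρ (in₁ t)          = cong in₁ (subst-rename σ ρ t)
  subst-rename σ ρ (in₂ t)          = cong in₂ (subst-rename σ ρ t)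
  subst-rename σ ρ (case t s₁ s₂)   = cong₃ case (subst-rename σ ρ t)
    (trans (subst-rename _ _ s₁) (subst-cong exts-ext s₁))
    (trans (subst-rename _ _ s₂) (subst-cong exts-ext s₂))
  subst-rename σ ρ (V n t s₁ s₂ us) = cong₄ (V n)
    (trans (subst-rename _ _ t) (subst-cong (extsⁿ-extⁿ (suc n)) t))
    (trans (subst-rename _ _ s₁) (subst-cong exts-ext s₁))
    (trans (subst-rename _ _ s₂) (subst-cong exts-ext s₂))
    (trans (substVec-rename _ _ us) (substVec-cong exts-ext us))

  substVec-rename : ∀ {m} σ ρ (us : Vec Tm m) → substVec σ (renameVec ρ us) ≡ substVec (σ ∘ ρ) us
  substVec-rename σ ρ []ᵛ       = refl
  substVec-rename σ ρ (u ∷ᵛ us) = cong₂ _∷ᵛ_ (subst-rename σ ρ u) (substVec-rename σ ρ us)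

rename-fusion : ∀ ρ ρ' t → rename ρ' (rename ρ t) ≡ rename (ρ' ∘ ρ) t
rename-fusion ρ ρ' t = begin
  rename ρ' (rename ρ t)        ≡⟨ rename-as-subst ρ' (rename ρ t) ⟩
  subst (var ∘ ρ') (rename ρ t) ≡⟨ subst-rename (var ∘ ρ') ρ t ⟩
  subst (var ∘ ρ' ∘ ρ) t        ≡⟨ sym (rename-as-subst (ρ' ∘ ρ) t) ⟩
  rename (ρ' ∘ ρ) t             ∎
  where open ≡-Reasoning

ext-exts : ∀ {ρ σ} → (rename (ext ρ) ∘ exts σ) ≗ exts (rename ρ ∘ σ)
ext-exts zero = refl
ext-exts {ρ} {σ} (suc k) = trans (rename-fusion suc (ext ρ) (σ k)) (sym (rename-fusion ρ suc (σ k)))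

extⁿ-extsⁿ : ∀ n {ρ σ} → (rename (extⁿ n ρ) ∘ extsⁿ n σ) ≗ extsⁿ n (rename ρ ∘ σ)
extⁿ-extsⁿ zero    k = refl
extⁿ-extsⁿ (suc n) {ρ} {σ} k = trans (ext-exts {extⁿ n ρ} {extsⁿ n σ} k) (exts-cong (extⁿ-extsⁿ n) k)

mutual
  rename-subst : ∀ ρ σ t → rename ρ (subst σ t) ≡ subst (rename ρ ∘ σ) t
  rename-subst ρ σ (var k)          = refl
  rename-subst ρ σ (app t s)        = cong₂ app (rename-subst ρ σ t) (rename-subst ρ σ s)
  rename-subst ρ σ (lam t)          = cong lam (trans (rename-subst _ _ t) (subst-cong ext-exts t))
  rename-subst ρ σ (efq t)          = cong efq (rename-subst ρ σ t)
  rename-subst ρ σ (pair t s)       = cong₂ pair (rename-subst ρ σ t) (rename-subst ρ σ s)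
  rename-subst ρ σ (π₁ t)           = cong π₁ (rename-subst ρ σ t)
  rename-subst ρ σ (π₂ t)           = cong π₂ (rename-subst ρ σ t)
  rename-subst ρ σ (in₁ t)          = cong in₁ (rename-subst ρ σ t)
  rename-subst ρ σ (in₂ t)          = cong in₂ (rename-subst ρ σ t)
  rename-subst ρ σ (case t s₁ s₂)   = cong₃ case (rename-subst ρ σ t)
    (trans (rename-subst _ _ s₁) (subst-cong ext-exts s₁))
    (trans (rename-subst _ _ s₂) (subst-cong ext-exts s₂))
  rename-subst ρ σ (V n t s₁ s₂ us) = cong₄ (V n)
    (trans (rename-subst _ _ t) (subst-cong (extⁿ-extsⁿ (suc n)) t))
    (trans (rename-subst _ _ s₁) (subst-cong ext-exts s₁))
    (trans (rename-subst _ _ s₂) (subst-cong ext-exts s₂))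
    (trans (renameVec-subst _ _ us) (substVec-cong ext-exts us))

  renameVec-subst : ∀ {m} ρ σ (us : Vec Tm m) → renameVec ρ (substVec σ us) ≡ substVec (rename ρ ∘ σ) us
  renameVec-subst ρ σ []ᵛ       = refl
  renameVec-subst ρ σ (u ∷ᵛ us) = cong₂ _∷ᵛ_ (rename-subst ρ σ u) (renameVec-subst ρ σ us)

exts-exts : ∀ {τ σ} → (subst (exts τ) ∘ exts σ) ≗ exts (subst τ ∘ σ)
exts-exts zero = refl
exts-exts {τ} {σ} (suc k) = trans (subst-rename (exts τ) suc (σ k)) (sym (rename-subst suc τ (σ k)))

extsⁿ-extsⁿ : ∀ n {τ σ} → (subst (extsⁿ n τ) ∘ extsⁿ n σ) ≗ extsⁿ n (subst τ ∘ σ)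
extsⁿ-extsⁿ zero    k = refl
extsⁿ-extsⁿ (suc n) {τ} {σ} k = trans (exts-exts {extsⁿ n τ} {extsⁿ n σ} k) (exts-cong (extsⁿ-extsⁿ n) k)

mutual
  subst-subst : ∀ τ σ t → subst τ (subst σ t) ≡ subst (subst τ ∘ σ) t
  subst-subst τ σ (var k)          = refl
  subst-subst τ σ (app t s)        = cong₂ app (subst-subst τ σ t) (subst-subst τ σ s)
  subst-subst τ σ (lam t)          = cong lam (trans (subst-subst _ _ t) (subst-cong exts-exts t))
  subst-subst τ σ (efq t)          = cong efq (subst-subst τ σ t)
  subst-subst τ σ (pair t s)       = cong₂ pair (subst-subst τ σ t) (subst-subst τ σ s)
  subst-subst τ σ (π₁ t)           = cong π₁ (subst-subst τ σ t)
  subst-subst τ σ (π₂ t)           = cong π₂ (subst-subst τ σ t)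
  subst-subst τ σ (in₁ t)          = cong in₁ (subst-subst τ σ t)
  subst-subst τ σ (in₂ t)          = cong in₂ (subst-subst τ σ t)
  subst-subst τ σ (case t s₁ s₂)   = cong₃ case (subst-subst τ σ t)
    (trans (subst-subst _ _ s₁) (subst-cong exts-exts s₁))
    (trans (subst-subst _ _ s₂) (subst-cong exts-exts s₂))
  subst-subst τ σ (V n t s₁ s₂ us) = cong₄ (V n)
    (trans (subst-subst _ _ t) (subst-cong (extsⁿ-extsⁿ (suc n)) t))
    (trans (subst-subst _ _ s₁) (subst-cong exts-exts s₁))
    (trans (subst-subst _ _ s₂) (subst-cong exts-exts s₂))
    (trans (substVec-subst _ _ us) (substVec-cong exts-exts us))

  substVec-subst : ∀ {m} τ σ (us : Vec Tm m) → substVec τ (substVec σ us) ≡ substVec (subst τ ∘ σ) us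
  substVec-subst τ σ []ᵛ       = refl
  substVec-subst τ σ (u ∷ᵛ us) = cong₂ _∷ᵛ_ (subst-subst τ σ u) (substVec-subst τ σ us)

_∙_ : Tm → (ℕ → Tm) → ℕ → Tm
(s ∙ σ) zero    = s
(s ∙ σ) (suc k) = σ k

exts-single : ∀ σ u s → (subst (exts σ) s) [ u ] ≡ subst (u ∙ σ) s
exts-single σ u s = trans (subst-subst (single u) (exts σ) s) (subst-cong pointwise s)
  where
  pointwise : (subst (single u) ∘ exts σ) ≗ (u ∙ σ)
  pointwise zero    = refl
  pointwise (suc k) = trans (subst-rename (single u) suc (σ k)) (subst-id (λ _ → refl) (σ k))

-- The same, when the body is additionally renamed (a β-step of a renamed abstraction).
ext-exts-single : ∀ ρ σ s b → (rename (ext ρ) (subst (exts σ) b)) [ s ] ≡ subst (s ∙ (rename ρ ∘ σ)) b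
ext-exts-single ρ σ s b = begin
  (rename (ext ρ) (subst (exts σ) b)) [ s ]  ≡⟨ subst-rename (single s) (ext ρ) (subst (exts σ) b) ⟩
  subst (single s ∘ ext ρ) (subst (exts σ) b) ≡⟨ subst-subst (single s ∘ ext ρ) (exts σ) b ⟩
  subst (subst (single s ∘ ext ρ) ∘ exts σ) b ≡⟨ subst-cong pointwise b ⟩
  subst (s ∙ (rename ρ ∘ σ)) b                ∎
  where
  open ≡-Reasoning
  pointwise : (subst (single s ∘ ext ρ) ∘ exts σ) ≗ (s ∙ (rename ρ ∘ σ))
  pointwise zero    = refl
  pointwise (suc k) = trans (subst-rename (single s ∘ ext ρ) suc (σ k)) (sym (rename-as-subst ρ (σ k)))

rename-single : ∀ ρ t s → rename ρ (t [ s ]) ≡ (rename (ext ρ) t) [ rename ρ s ]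
rename-single ρ t s = trans (rename-subst ρ (single s) t)
  (trans (subst-cong pointwise t) (sym (subst-rename (single (rename ρ s)) (ext ρ) t)))
  where
  pointwise : (rename ρ ∘ single s) ≗ (single (rename ρ s) ∘ ext ρ)
  pointwise zero    = refl
  pointwise (suc k) = refl

Ren : Ctx → Ctx → (ℕ → ℕ) → Set
Ren Γ Δ ρ = ∀ {k B} → Γ ∋ k ∶ B → Δ ∋ ρ k ∶ B

ext-ren : ∀ {Γ Δ ρ A} → Ren Γ Δ ρ → Ren (A ∷ Γ) (A ∷ Δ) (ext ρ)
ext-ren h here      = here
ext-ren h (there p) = there (h p)

rename-typ : ∀ {Γ Δ ρ t A} → Ren Γ Δ ρ → Γ ⊢IPC t ∶ A → Δ ⊢IPC rename ρ t ∶ A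
rename-typ h (ax p)     = ax (h p)
rename-typ h (⇒I d)     = ⇒I (rename-typ (ext-ren h) d)
rename-typ h (⇒E d e)   = ⇒E (rename-typ h d) (rename-typ h e)
rename-typ h (∧I d e)   = ∧I (rename-typ h d) (rename-typ h e)
rename-typ h (∧E₁ d)    = ∧E₁ (rename-typ h d)
rename-typ h (∧E₂ d)    = ∧E₂ (rename-typ h d)
rename-typ h (∨I₁ d)    = ∨I₁ (rename-typ h d)
rename-typ h (∨I₂ d)    = ∨I₂ (rename-typ h d)
rename-typ h (∨E d e f) = ∨E (rename-typ h d) (rename-typ (ext-ren h) e) (rename-typ (ext-ren h) f)
rename-typ h (⊥E d)     = ⊥E (rename-typ h d)

weaken : ∀ {Δ u A} Γ → Δ ⊢IPC u ∶ A → (Δ ++ Γ) ⊢IPC u ∶ A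
weaken {Δ} {u} {A} Γ d = transport (λ x → (Δ ++ Γ) ⊢IPC x ∶ A) (rename-id u) (rename-typ (prefix Δ) d)
  where
  prefix : ∀ Δ → Ren Δ (Δ ++ Γ) id
  prefix (B ∷ Δ) here      = here
  prefix (B ∷ Δ) (there p) = there (prefix Δ p)

Sub : Ctx → Ctx → (ℕ → Tm) → Set
Sub Γ Δ σ = ∀ {k B} → Γ ∋ k ∶ B → Δ ⊢IPC σ k ∶ B

exts-sub : ∀ {Γ Δ σ A} → Sub Γ Δ σ → Sub (A ∷ Γ) (A ∷ Δ) (exts σ)
exts-sub h here      = ax here
exts-sub h (there p) = rename-typ there (h p)

subst-typ : ∀ {Γ Δ σ t A} → Sub Γ Δ σ → Γ ⊢IPC t ∶ A → Δ ⊢IPC subst σ t ∶ A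
subst-typ h (ax p)     = h p
subst-typ h (⇒I d)     = ⇒I (subst-typ (exts-sub h) d)
subst-typ h (⇒E d e)   = ⇒E (subst-typ h d) (subst-typ h e)
subst-typ h (∧I d e)   = ∧I (subst-typ h d) (subst-typ h e)
subst-typ h (∧E₁ d)    = ∧E₁ (subst-typ h d)
subst-typ h (∧E₂ d)    = ∧E₂ (subst-typ h d)
subst-typ h (∨I₁ d)    = ∨I₁ (subst-typ h d)
subst-typ h (∨I₂ d)    = ∨I₂ (subst-typ h d)
subst-typ h (∨E d e f) = ∨E (subst-typ h d) (subst-typ (exts-sub h) e) (subst-typ (exts-sub h) f)
subst-typ h (⊥E d)     = ⊥E (subst-typ h d)

single-typ : ∀ {Γ A B t s} → (A ∷ Γ) ⊢IPC t ∶ B → Γ ⊢IPC s ∶ A → Γ ⊢IPC t [ s ] ∶ B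
single-typ {Γ} {A} {s = s} d e = subst-typ cut d
  where
  cut : Sub (A ∷ Γ) Γ (single s)
  cut here      = e
  cut (there p) = ax p

infix 4 _↝_ _↝*_

data _↝_ : Tm → Tm → Set where
  β      : ∀ {t s} → app (lam t) s ↝ t [ s ]
  π₁β    : ∀ {t₁ t₂} → π₁ (pair t₁ t₂) ↝ t₁
  π₂β    : ∀ {t₁ t₂} → π₂ (pair t₁ t₂) ↝ t₂
  case₁  : ∀ {t s₁ s₂} → case (in₁ t) s₁ s₂ ↝ s₁ [ t ]
  case₂  : ∀ {t s₁ s₂} → case (in₂ t) s₁ s₂ ↝ s₂ [ t ]
  appL   : ∀ {t t' s} → t ↝ t' → app t s ↝ app t' s
  appR   : ∀ {t s s'} → s ↝ s' → app t s ↝ app t s'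
  lamC   : ∀ {t t'} → t ↝ t' → lam t ↝ lam t'
  efqC   : ∀ {t t'} → t ↝ t' → efq t ↝ efq t'
  pairL  : ∀ {t t' s} → t ↝ t' → pair t s ↝ pair t' s
  pairR  : ∀ {t s s'} → s ↝ s' → pair t s ↝ pair t s'
  π₁C    : ∀ {t t'} → t ↝ t' → π₁ t ↝ π₁ t'
  π₂C    : ∀ {t t'} → t ↝ t' → π₂ t ↝ π₂ t'
  in₁C   : ∀ {t t'} → t ↝ t' → in₁ t ↝ in₁ t'
  in₂C   : ∀ {t t'} → t ↝ t' → in₂ t ↝ in₂ t'
  caseC  : ∀ {t t' s₁ s₂} → t ↝ t' → case t s₁ s₂ ↝ case t' s₁ s₂
  case₁C : ∀ {t s₁ s₁' s₂} → s₁ ↝ s₁' → case t s₁ s₂ ↝ case t s₁' s₂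
  case₂C : ∀ {t s₁ s₂ s₂'} → s₂ ↝ s₂' → case t s₁ s₂ ↝ case t s₁ s₂'

_↝*_ : Tm → Tm → Set
_↝*_ = Star _↝_

app↝* : ∀ {t t' s s'} → t ↝* t' → s ↝* s' → app t s ↝* app t' s'
app↝* {t' = t'} {s = s} r r' = gmap (λ x → app x s) appL r ◅◅ gmap (app t') appR r'

pair↝* : ∀ {t t' s s'} → t ↝* t' → s ↝* s' → pair t s ↝* pair t' s'
pair↝* {t' = t'} {s = s} r r' = gmap (λ x → pair x s) pairL r ◅◅ gmap (pair t') pairR r'

case↝* : ∀ {t t' s₁ s₁' s₂ s₂'} → t ↝* t' → s₁ ↝* s₁' → s₂ ↝* s₂' → case t s₁ s₂ ↝* case t' s₁' s₂'
case↝* {t' = t'} {s₁ = s₁} {s₁'} {s₂} r r₁ r₂ =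
  gmap (λ x → case x s₁ s₂) caseC r ◅◅ gmap (λ x → case t' x s₂) case₁C r₁ ◅◅ gmap (case t' s₁') case₂C r₂

embed : ∀ {t t'} → t ↝ t' → t →V t'
embed β          = top β
embed π₁β        = top π₁β
embed π₂β        = top π₂β
embed case₁      = top case₁
embed case₂      = top case₂
embed (appL r)   = appL (embed r)
embed (appR r)   = appR (embed r)
embed (lamC r)   = lamC (embed r)
embed (efqC r)   = efqC (embed r)
embed (pairL r)  = pairL (embed r)
embed (pairR r)  = pairR (embed r)
embed (π₁C r)    = π₁C (embed r)
embed (π₂C r)    = π₂C (embed r)
embed (in₁C r)   = in₁C (embed r)
embed (in₂C r)   = in₂C (embed r)
embed (caseC r)  = caseC (embed r)
embed (case₁C r) = case₁C (embed r)
embed (case₂C r) = case₂C (embed r)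

embed* : ∀ {t t'} → t ↝* t' → t →V* t'
embed* = gmap id embed

preserve : ∀ {Γ t t' A} → t ↝ t' → Γ ⊢IPC t ∶ A → Γ ⊢IPC t' ∶ A
preserve β          (⇒E (⇒I d) e)      = single-typ d e
preserve π₁β        (∧E₁ (∧I d e))     = d
preserve π₂β        (∧E₂ (∧I d e))     = e
preserve case₁      (∨E (∨I₁ d) e f)   = single-typ e d
preserve case₂      (∨E (∨I₂ d) e f)   = single-typ f d
preserve (appL r)   (⇒E d e)   = ⇒E (preserve r d) e
preserve (appR r)   (⇒E d e)   = ⇒E d (preserve r e)
preserve (lamC r)   (⇒I d)     = ⇒I (preserve r d)
preserve (efqC r)   (⊥E d)     = ⊥E (preserve r d)
preserve (pairL r)  (∧I d e)   = ∧I (preserve r d) e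
preserve (pairR r)  (∧I d e)   = ∧I d (preserve r e)
preserve (π₁C r)    (∧E₁ d)    = ∧E₁ (preserve r d)
preserve (π₂C r)    (∧E₂ d)    = ∧E₂ (preserve r d)
preserve (in₁C r)   (∨I₁ d)    = ∨I₁ (preserve r d)
preserve (in₂C r)   (∨I₂ d)    = ∨I₂ (preserve r d)
preserve (caseC r)  (∨E d e f) = ∨E (preserve r d) e f
preserve (case₁C r) (∨E d e f) = ∨E d (preserve r e) f
preserve (case₂C r) (∨E d e f) = ∨E d e (preserve r f)

preserve* : ∀ {Γ t t' A} → t ↝* t' → Γ ⊢IPC t ∶ A → Γ ⊢IPC t' ∶ A
preserve* ε        d = d
preserve* (r ◅ rs) d = preserve* rs (preserve r d)

rename↝ : ∀ ρ {t t'} → t ↝ t' → rename ρ t ↝ rename ρ t'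
rename↝ ρ (β {t} {s}) =
  transport (λ x → rename ρ (app (lam t) s) ↝ x) (sym (rename-single ρ t s)) β
rename↝ ρ π₁β = π₁β
rename↝ ρ π₂β = π₂β
rename↝ ρ (case₁ {t} {s₁} {s₂}) =
  transport (λ x → rename ρ (case (in₁ t) s₁ s₂) ↝ x) (sym (rename-single ρ s₁ t)) case₁
rename↝ ρ (case₂ {t} {s₁} {s₂}) =
  transport (λ x → rename ρ (case (in₂ t) s₁ s₂) ↝ x) (sym (rename-single ρ s₂ t)) case₂
rename↝ ρ (appL r)   = appL (rename↝ ρ r)
rename↝ ρ (appR r)   = appR (rename↝ ρ r)
rename↝ ρ (lamC r)   = lamC (rename↝ (ext ρ) r)
rename↝ ρ (efqC r)   = efqC (rename↝ ρ r)
rename↝ ρ (pairL r)  = pairL (rename↝ ρ r)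
rename↝ ρ (pairR r)  = pairR (rename↝ ρ r)
rename↝ ρ (π₁C r)    = π₁C (rename↝ ρ r)
rename↝ ρ (π₂C r)    = π₂C (rename↝ ρ r)
rename↝ ρ (in₁C r)   = in₁C (rename↝ ρ r)
rename↝ ρ (in₂C r)   = in₂C (rename↝ ρ r)
rename↝ ρ (caseC r)  = caseC (rename↝ ρ r)
rename↝ ρ (case₁C r) = case₁C (rename↝ (ext ρ) r)
rename↝ ρ (case₂C r) = case₂C (rename↝ (ext ρ) r)

rename↝* : ∀ ρ {t t'} → t ↝* t' → rename ρ t ↝* rename ρ t'
rename↝* ρ = gmap (rename ρ) (rename↝ ρ)

mutual
  data Ne : Tm → Set where
    var  : ∀ {k} → Ne (var k)
    app  : ∀ {t s} → Ne t → Nf s → Ne (app t s)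
    π₁   : ∀ {t} → Ne t → Ne (π₁ t)
    π₂   : ∀ {t} → Ne t → Ne (π₂ t)
    case : ∀ {t s₁ s₂} → Ne t → Nf s₁ → Nf s₂ → Ne (case t s₁ s₂)
    efq  : ∀ {t} → Nf t → Ne (efq t)

  data Nf : Tm → Set where
    ne   : ∀ {t} → Ne t → Nf t
    lam  : ∀ {t} → Nf t → Nf (lam t)
    pair : ∀ {t s} → Nf t → Nf s → Nf (pair t s)
    in₁  : ∀ {t} → Nf t → Nf (in₁ t)
    in₂  : ∀ {t} → Nf t → Nf (in₂ t)

mutual
  ne-ipc : ∀ {t} → Ne t → IPCTerm t
  ne-ipc var          = var
  ne-ipc (app e n)    = app (ne-ipc e) (nf-ipc n)
  ne-ipc (π₁ e)       = π₁ (ne-ipc e)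
  ne-ipc (π₂ e)       = π₂ (ne-ipc e)
  ne-ipc (case e n m) = case (ne-ipc e) (nf-ipc n) (nf-ipc m)
  ne-ipc (efq n)      = efq (nf-ipc n)

  nf-ipc : ∀ {t} → Nf t → IPCTerm t
  nf-ipc (ne e)     = ne-ipc e
  nf-ipc (lam n)    = lam (nf-ipc n)
  nf-ipc (pair n m) = pair (nf-ipc n) (nf-ipc m)
  nf-ipc (in₁ n)    = in₁ (nf-ipc n)
  nf-ipc (in₂ n)    = in₂ (nf-ipc n)

-- Normal forms admit no →V step: a neutral term is never an introduction,
-- so no β-like rule fires at its head, and no V-rule applies to a V-free term.
mutual
  ne-normal : ∀ {t} → Ne t → Normal t
  ne-normal var          _ (top ())
  ne-normal (app () n)   _ (top β)
  ne-normal (app e n)    _ (appL r)   = ne-normal e _ r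
  ne-normal (app e n)    _ (appR r)   = nf-normal n _ r
  ne-normal (π₁ ())      _ (top π₁β)
  ne-normal (π₁ e)       _ (π₁C r)    = ne-normal e _ r
  ne-normal (π₂ ())      _ (top π₂β)
  ne-normal (π₂ e)       _ (π₂C r)    = ne-normal e _ r
  ne-normal (case () n m) _ (top case₁)
  ne-normal (case () n m) _ (top case₂)
  ne-normal (case e n m) _ (caseC r)  = ne-normal e _ r
  ne-normal (case e n m) _ (case₁C r) = nf-normal n _ r
  ne-normal (case e n m) _ (case₂C r) = nf-normal m _ r
  ne-normal (efq n)      _ (top ())
  ne-normal (efq n)      _ (efqC r)   = nf-normal n _ r

  nf-normal : ∀ {t} → Nf t → Normal t
  nf-normal (ne e)     = ne-normal e
  nf-normal (lam n)    _ (top ())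
  nf-normal (lam n)    _ (lamC r)  = nf-normal n _ r
  nf-normal (pair n m) _ (top ())
  nf-normal (pair n m) _ (pairL r) = nf-normal n _ r
  nf-normal (pair n m) _ (pairR r) = nf-normal m _ r
  nf-normal (in₁ n)    _ (top ())
  nf-normal (in₁ n)    _ (in₁C r)  = nf-normal n _ r
  nf-normal (in₂ n)    _ (top ())
  nf-normal (in₂ n)    _ (in₂C r)  = nf-normal n _ r

mutual
  rename-ne : ∀ ρ {t} → Ne t → Ne (rename ρ t)
  rename-ne ρ var          = var
  rename-ne ρ (app e n)    = app (rename-ne ρ e) (rename-nf ρ n)
  rename-ne ρ (π₁ e)       = π₁ (rename-ne ρ e)
  rename-ne ρ (π₂ e)       = π₂ (rename-ne ρ e)
  rename-ne ρ (case e n m) = case (rename-ne ρ e) (rename-nf (ext ρ) n) (rename-nf (ext ρ) m)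
  rename-ne ρ (efq n)      = efq (rename-nf ρ n)

  rename-nf : ∀ ρ {t} → Nf t → Nf (rename ρ t)
  rename-nf ρ (ne e)     = ne (rename-ne ρ e)
  rename-nf ρ (lam n)    = lam (rename-nf (ext ρ) n)
  rename-nf ρ (pair n m) = pair (rename-nf ρ n) (rename-nf ρ m)
  rename-nf ρ (in₁ n)    = in₁ (rename-nf ρ n)
  rename-nf ρ (in₂ n)    = in₂ (rename-nf ρ n)

-- Weak normalisation of IPC, by Kripke reducibility predicates.

WN : Tm → Set
WN t = Σ Tm (λ n → (t ↝* n) × Nf n)

-- Implications quantify over renamings so that the
-- predicate is stable under going under binders; conjunctions and
-- disjunctions either reduce to an introduction or get stuck on a neutral.
Red : Form → Tm → Set
Red (atom _) t = WN t
Red ⊥'       t = WN t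
Red (A ⇒ B)  t = WN t × (∀ ρ s → Red A s → Red B (app (rename ρ t) s))
Red (A ∧ B)  t = Σ Tm (λ u → Σ Tm (λ v → (t ↝* pair u v) × Red A u × Red B v))
               ⊎ Σ Tm (λ n → (t ↝* n) × Ne n)
Red (A ∨ B)  t = Σ Tm (λ u → (t ↝* in₁ u) × Red A u)
               ⊎ (Σ Tm (λ u → (t ↝* in₂ u) × Red B u)
               ⊎ Σ Tm (λ n → (t ↝* n) × Ne n))

red-wn : ∀ A {t} → Red A t → WN t
red-wn (atom _) r = r
red-wn ⊥'       r = r
red-wn (A ⇒ B)  r = proj₁ r
red-wn (A ∧ B) (inj₁ (u , v , r , ru , rv)) with red-wn A ru | red-wn B rv
... | (n , rn , nn) | (m , rm , nm) = pair n m , r ◅◅ pair↝* rn rm , pair nn nm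
red-wn (A ∧ B) (inj₂ (n , r , e)) = n , r , ne e
red-wn (A ∨ B) (inj₁ (u , r , ru)) with red-wn A ru
... | (n , rn , nn) = in₁ n , r ◅◅ gmap in₁ in₁C rn , in₁ nn
red-wn (A ∨ B) (inj₂ (inj₁ (u , r , ru))) with red-wn B ru
... | (n , rn , nn) = in₂ n , r ◅◅ gmap in₂ in₂C rn , in₂ nn
red-wn (A ∨ B) (inj₂ (inj₂ (n , r , e))) = n , r , ne e

red-expand : ∀ A {t t'} → t ↝* t' → Red A t' → Red A t
red-expand (atom _) rs (n , r , nn) = n , rs ◅◅ r , nn
red-expand ⊥'       rs (n , r , nn) = n , rs ◅◅ r , nn
red-expand (A ⇒ B)  rs ((n , r , nn) , f) =
  (n , rs ◅◅ r , nn) ,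
  λ ρ s rA → red-expand B (app↝* (rename↝* ρ rs) ε) (f ρ s rA)
red-expand (A ∧ B) rs (inj₁ (u , v , r , x))         = inj₁ (u , v , rs ◅◅ r , x)
red-expand (A ∧ B) rs (inj₂ (n , r , e))             = inj₂ (n , rs ◅◅ r , e)
red-expand (A ∨ B) rs (inj₁ (u , r , x))             = inj₁ (u , rs ◅◅ r , x)
red-expand (A ∨ B) rs (inj₂ (inj₁ (u , r , x)))      = inj₂ (inj₁ (u , rs ◅◅ r , x))
red-expand (A ∨ B) rs (inj₂ (inj₂ (n , r , e)))      = inj₂ (inj₂ (n , rs ◅◅ r , e))

red-ne : ∀ A {t n} → t ↝* n → Ne n → Red A t
red-ne (atom _) rs e = _ , rs , ne e
red-ne ⊥'       rs e = _ , rs , ne e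
red-ne (A ⇒ B) {t} {n} rs e = (_ , rs , ne e) , λ ρ s rA → applied ρ s (red-wn A rA)
  where
  applied : ∀ ρ s → WN s → Red B (app (rename ρ t) s)
  applied ρ s (m , rm , nm) = red-ne B (app↝* (rename↝* ρ rs) rm) (app (rename-ne ρ e) nm)
red-ne (A ∧ B) rs e = inj₂ (_ , rs , e)
red-ne (A ∨ B) rs e = inj₂ (inj₂ (_ , rs , e))

rename-red : ∀ A ρ {t} → Red A t → Red A (rename ρ t)
rename-red (atom _) ρ (n , r , nn) = rename ρ n , rename↝* ρ r , rename-nf ρ nn
rename-red ⊥'       ρ (n , r , nn) = rename ρ n , rename↝* ρ r , rename-nf ρ nn
rename-red (A ⇒ B)  ρ {t} ((n , r , nn) , f) =
  (rename ρ n , rename↝* ρ r , rename-nf ρ nn) ,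
  λ ρ' s rA → transport (λ x → Red B (app x s)) (sym (rename-fusion ρ ρ' t)) (f (ρ' ∘ ρ) s rA)
rename-red (A ∧ B) ρ (inj₁ (u , v , r , ru , rv)) =
  inj₁ (rename ρ u , rename ρ v , rename↝* ρ r , rename-red A ρ ru , rename-red B ρ rv)
rename-red (A ∧ B) ρ (inj₂ (n , r , e)) = inj₂ (rename ρ n , rename↝* ρ r , rename-ne ρ e)
rename-red (A ∨ B) ρ (inj₁ (u , r , ru)) = inj₁ (rename ρ u , rename↝* ρ r , rename-red A ρ ru)
rename-red (A ∨ B) ρ (inj₂ (inj₁ (u , r , ru))) =
  inj₂ (inj₁ (rename ρ u , rename↝* ρ r , rename-red B ρ ru))
rename-red (A ∨ B) ρ (inj₂ (inj₂ (n , r , e))) = inj₂ (inj₂ (rename ρ n , rename↝* ρ r , rename-ne ρ e))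

RedSub : Ctx → (ℕ → Tm) → Set
RedSub Γ σ = ∀ {k B} → Γ ∋ k ∶ B → Red B (σ k)

exts-red : ∀ {Γ σ A} → RedSub Γ σ → RedSub (A ∷ Γ) (exts σ)
exts-red {A = A} h here = red-ne A ε var
exts-red h (there p)    = rename-red _ suc (h p)

cons-red : ∀ {Γ σ A u} → RedSub Γ σ → Red A u → RedSub (A ∷ Γ) (u ∙ σ)
cons-red h r here      = r
cons-red h r (there p) = h p

rename-redsub : ∀ {Γ σ} ρ → RedSub Γ σ → RedSub Γ (rename ρ ∘ σ)
rename-redsub ρ h p = rename-red _ ρ (h p)

fundamental : ∀ {Γ t A} → Γ ⊢IPC t ∶ A → ∀ σ → RedSub Γ σ → Red A (subst σ t)
fundamental (ax p) σ h = h p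
fundamental {A = A ⇒ B} (⇒I {t = b} d) σ h with red-wn B (fundamental d (exts σ) (exts-red h))
... | (n , r , nn) = (lam n , gmap lam lamC r , lam nn) , apply
  where
  apply : ∀ ρ s → Red A s → Red B (app (rename ρ (subst σ (lam b))) s)
  apply ρ s rs = red-expand B (β ◅ ε)
    (transport (Red B) (sym (ext-exts-single ρ σ s b))
      (fundamental d (s ∙ (rename ρ ∘ σ)) (cons-red (rename-redsub ρ h) rs)))
fundamental (⇒E {t = t} {s = s} {B = B} d e) σ h =
  transport (λ x → Red B (app x (subst σ s))) (rename-id (subst σ t))
    (proj₂ (fundamental d σ h) id _ (fundamental e σ h))
fundamental (∧I d e) σ h = inj₁ (_ , _ , ε , fundamental d σ h , fundamental e σ h)
fundamental (∧E₁ {A = A} d) σ h with fundamental d σ h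
... | inj₁ (u , v , r , ru , rv) = red-expand A (gmap π₁ π₁C r ◅◅ π₁β ◅ ε) ru
... | inj₂ (n , r , e)           = red-ne A (gmap π₁ π₁C r) (π₁ e)
fundamental (∧E₂ {B = B} d) σ h with fundamental d σ h
... | inj₁ (u , v , r , ru , rv) = red-expand B (gmap π₂ π₂C r ◅◅ π₂β ◅ ε) rv
... | inj₂ (n , r , e)           = red-ne B (gmap π₂ π₂C r) (π₂ e)
fundamental (∨I₁ d) σ h = inj₁ (_ , ε , fundamental d σ h)
fundamental (∨I₂ d) σ h = inj₂ (inj₁ (_ , ε , fundamental d σ h))
fundamental (∨E {s₁ = s₁} {s₂ = s₂} {D = D} d e f) σ h with fundamental d σ h
... | inj₁ (u , r , ru) =
  red-expand D (case↝* r ε ε ◅◅ case₁ ◅ ε)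
    (transport (Red D) (sym (exts-single σ u s₁)) (fundamental e (u ∙ σ) (cons-red h ru)))
... | inj₂ (inj₁ (u , r , ru)) =
  red-expand D (case↝* r ε ε ◅◅ case₂ ◅ ε)
    (transport (Red D) (sym (exts-single σ u s₂)) (fundamental f (u ∙ σ) (cons-red h ru)))
... | inj₂ (inj₂ (n , r , en))
  with red-wn D (fundamental e (exts σ) (exts-red h)) | red-wn D (fundamental f (exts σ) (exts-red h))
... | (m₁ , r₁ , n₁) | (m₂ , r₂ , n₂) = red-ne D (case↝* r r₁ r₂) (case en n₁ n₂)
fundamental (⊥E {A = A} d) σ h with fundamental d σ h
... | (n , r , nn) = red-ne A (gmap efq efqC r) (efq nn)

weakly-normalising : ∀ {Γ t A} → Γ ⊢IPC t ∶ A → WN t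
weakly-normalising {t = t} {A} d =
  red-wn A (transport (Red A) (subst-id (λ _ → refl) t)
    (fundamental d var (λ {_} {B} _ → red-ne B ε var)))

normalise : ∀ {Γ t A} → Γ ⊢IPC t ∶ A → Σ Tm (λ n → (t →V* n) × Nf n × (Γ ⊢IPC n ∶ A))
normalise d with weakly-normalising d
... | (n , r , nn) = n , embed* r , nn , preserve* r d

hyps-cons : ∀ {m} B C (Bs Cs : Vec Form m) Γ →
  hyps (B ∷ᵛ Bs) (C ∷ᵛ Cs) ++ Γ ≡ hyps Bs Cs ++ (B ⇒ C ∷ Γ)
hyps-cons B C Bs Cs Γ =
  trans (sym (ʳ++-defn ((B ⇒ C) ∷ toList (zipWith _⇒_ Bs Cs)) {Γ}))
        (ʳ++-defn (toList (zipWith _⇒_ Bs Cs)))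

lams-typ : ∀ {m} (Bs Cs : Vec Form m) Γ {u E} →
  (hyps Bs Cs ++ Γ) ⊢IPC u ∶ E → Γ ⊢IPC lams m u ∶ chain Bs Cs E
lams-typ []ᵛ       []ᵛ       Γ d = d
lams-typ (B ∷ᵛ Bs) (C ∷ᵛ Cs) Γ {u} {E} d =
  ⇒I (lams-typ Bs Cs (B ⇒ C ∷ Γ) (transport (λ x → x ⊢IPC u ∶ E) (hyps-cons B C Bs Cs Γ) d))

discharge : ∀ {Γ m s u E D} (Bs Cs : Vec Form m) →
  (chain Bs Cs E ∷ Γ) ⊢IPC s ∶ D → hyps Bs Cs ⊢IPC u ∶ E → Γ ⊢IPC s [ lams m u ] ∶ D
discharge Bs Cs ds du = single-typ ds (lams-typ Bs Cs _ (weaken _ du))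

hyps-var : ∀ {m} (Bs Cs : Vec Form m) Γ {k T} → (hyps Bs Cs ++ Γ) ∋ k ∶ T →
  (Σ (Fin m) λ j → (k ≡ toℕ (opposite j)) × (T ≡ (lookup Bs j ⇒ lookup Cs j)))
  ⊎ (Σ ℕ λ k' → (k ≡ m + k') × (Γ ∋ k' ∶ T))
hyps-var []ᵛ []ᵛ Γ {k} p = inj₂ (k , refl , p)
hyps-var {suc m} (B ∷ᵛ Bs) (C ∷ᵛ Cs) Γ {k} {T} p
  with hyps-var Bs Cs (B ⇒ C ∷ Γ) (transport (λ x → x ∋ k ∶ T) (hyps-cons B C Bs Cs Γ) p)
... | inj₁ (j , k≡j , T≡j) = inj₁ (fs j , trans k≡j (sym (opposite-suc j)) , T≡j)
... | inj₂ (.zero , k≡m , here) =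
  inj₁ (fz , trans k≡m (trans (+-identityʳ m) (sym (toℕ-fromℕ m))) , refl)
... | inj₂ (.(suc k') , k≡m+1+k' , there {k = k'} q) = inj₂ (k' , trans k≡m+1+k' (+-suc m k') , q)

data Head {m} (Bs Cs : Vec Form m) : Tm → Form → Set where
  isVar : ∀ j → Head Bs Cs (var (toℕ (opposite j))) (lookup Bs j ⇒ lookup Cs j)
  isEfq : ∀ {T} W u → hyps Bs Cs ⊢IPC u ∶ ⊥' → Head Bs Cs (plug W (efq u)) T
  isHyp : ∀ {T} W j u → hyps Bs Cs ⊢IPC u ∶ lookup Bs j →
          Head Bs Cs (plug W (app (var (toℕ (opposite j))) u)) T

-- Every typed neutral term from the hypotheses has such a head: its head
-- variable is some xⱼ, and eliminating xⱼ : Bⱼ → Cⱼ must first apply it.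
classify : ∀ {m} (Bs Cs : Vec Form m) {e T} → Ne e → hyps Bs Cs ⊢IPC e ∶ T → Head Bs Cs e T
classify Bs Cs {var k} {T} var (ax p)
  with hyps-var Bs Cs [] (transport (λ x → x ∋ k ∶ T) (sym (++-identityʳ (hyps Bs Cs))) p)
... | inj₁ (j , refl , refl) = isVar j
... | inj₂ (_ , _ , ())
classify Bs Cs (app e _) (⇒E d d') with classify Bs Cs e d
... | isVar j        = isHyp □ j _ d'
... | isEfq W u du   = isEfq (appW W _) u du
... | isHyp W j u du = isHyp (appW W _) j u du
classify Bs Cs (π₁ e) (∧E₁ d) with classify Bs Cs e d
... | isEfq W u du   = isEfq (π₁W W) u du
... | isHyp W j u du = isHyp (π₁W W) j u du
classify Bs Cs (π₂ e) (∧E₂ d) with classify Bs Cs e d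
... | isEfq W u du   = isEfq (π₂W W) u du
... | isHyp W j u du = isHyp (π₂W W) j u du
classify Bs Cs (case e _ _) (∨E d _ _) with classify Bs Cs e d
... | isEfq W u du   = isEfq (caseW W _ _) u du
... | isHyp W j u du = isHyp (caseW W _ _) j u du
classify Bs Cs (efq _) (⊥E d) = isEfq □ _ d

record IPCReduct (Γ : Ctx) (t : Tm) (A : Form) : Set where
  constructor reduct
  field
    term   : Tm
    steps  : t →V* term
    typing : Γ ⊢IPC term ∶ A

expand : ∀ {Γ t t' A} → t →V* t' → IPCReduct Γ t' A → IPCReduct Γ t A
expand r (reduct u r' d) = reduct u (r ◅◅ r') d

lift₁ : ∀ {Γ Δ t A B} (f : Tm → Tm) → (∀ {a a'} → a →V a' → f a →V f a') →
        (∀ {a} → Δ ⊢IPC a ∶ B → Γ ⊢IPC f a ∶ A) → IPCReduct Δ t B → IPCReduct Γ (f t) A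
lift₁ f congf typ (reduct a r d) = reduct (f a) (gmap f congf r) (typ d)

lift₂ : ∀ {Γ t s A B C} (f : Tm → Tm → Tm) →
        (∀ {a a' b} → a →V a' → f a b →V f a' b) → (∀ {a b b'} → b →V b' → f a b →V f a b') →
        (∀ {a b} → Γ ⊢IPC a ∶ B → Γ ⊢IPC b ∶ C → Γ ⊢IPC f a b ∶ A) →
        IPCReduct Γ t B → IPCReduct Γ s C → IPCReduct Γ (f t s) A
lift₂ {s = s} f congL congR typ (reduct a r d) (reduct b r' d') =
  reduct (f a b) (gmap (λ x → f x s) congL r ◅◅ gmap (f a) congR r') (typ d d')

V-branch* : ∀ {n t s₁ s₂} (us : Vec Tm (suc n)) j {u'} → lookup us j →V* u' →
            V n t s₁ s₂ us →V* V n t s₁ s₂ (us [ j ]≔ u')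
V-branch* us j = go us refl
  where
  -- generalised over the current branch a, so that the recursion is structural
  go : ∀ {n t s₁ s₂} (us : Vec Tm (suc n)) {j a u'} → lookup us j ≡ a → a →V* u' →
       V n t s₁ s₂ us →V* V n t s₁ s₂ (us [ j ]≔ u')
  go {n} {t} {s₁} {s₂} us {j} refl ε =
    transport (λ vs → V n t s₁ s₂ us →V* V n t s₁ s₂ vs) (sym ([]≔-lookup us j)) ε
  go {n} {t} {s₁} {s₂} us {j} refl (_◅_ {j = a} r rs) =
    VuC j r ◅ transport (λ vs → V n t s₁ s₂ (us [ j ]≔ a) →V* V n t s₁ s₂ vs) ([]≔-idempotent us j)
      (go (us [ j ]≔ a) (lookup∘update j us a) rs)

fire-neutral : ∀ {Γ n t s₁ s₂ us A₁ A₂ D} (Bs Cs : Vec Form (suc n)) → Head Bs Cs t (A₁ ∨ A₂) →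
  IPCReduct (chain Bs Cs A₁ ∷ Γ) s₁ D →
  (∀ j → IPCReduct (chain Bs Cs (lookup Bs j) ∷ Γ) (lookup us j) D) →
  IPCReduct Γ (V n t s₁ s₂ us) D
fire-neutral Bs Cs (isEfq W u du) (reduct _ r ds') hs =
  reduct _ (gmap _ Vs₁C r ◅◅ top (V-efq {W = W}) ◅ ε) (discharge Bs Cs ds' (⊥E du))
fire-neutral {n = n} {t} {s₁} {s₂} {us} Bs Cs (isHyp W j u du) _ hs with hs j
... | reduct u' r du' = reduct _ (V-branch* us j r ◅◅ contract ◅ ε) (discharge Bs Cs du' du)
  where
  contract : V n t s₁ s₂ (us [ j ]≔ u') →V u' [ lams (suc n) u ]
  contract = transport (λ x → V n t s₁ s₂ (us [ j ]≔ u') →V x [ lams (suc n) u ])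
               (lookup∘update j us u') (top (V-hyp {W = W} j))

fire : ∀ {Γ n t s₁ s₂ us A₁ A₂ D} (Bs Cs : Vec Form (suc n)) →
  Nf t → hyps Bs Cs ⊢IPC t ∶ A₁ ∨ A₂ →
  IPCReduct (chain Bs Cs A₁ ∷ Γ) s₁ D → IPCReduct (chain Bs Cs A₂ ∷ Γ) s₂ D →
  (∀ j → IPCReduct (chain Bs Cs (lookup Bs j) ∷ Γ) (lookup us j) D) →
  IPCReduct Γ (V n t s₁ s₂ us) D
fire Bs Cs (in₁ _) (∨I₁ du) (reduct _ r ds') _ _ =
  reduct _ (gmap _ Vs₁C r ◅◅ top V-in₁ ◅ ε) (discharge Bs Cs ds' du)
fire Bs Cs (in₂ _) (∨I₂ du) _ (reduct _ r ds') _ =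
  reduct _ (gmap _ Vs₂C r ◅◅ top V-in₂ ◅ ε) (discharge Bs Cs ds' du)
fire Bs Cs (ne e) d h₁ _ hs = fire-neutral Bs Cs (classify Bs Cs e d) h₁ hs

eliminate : ∀ {Γ t A} → Γ ⊢V t ∶ A → IPCReduct Γ t A
eliminate (ax p)     = reduct _ ε (ax p)
eliminate (⇒I d)     = lift₁ lam lamC ⇒I (eliminate d)
eliminate (⇒E d e)   = lift₂ app appL appR ⇒E (eliminate d) (eliminate e)
eliminate (∧I d e)   = lift₂ pair pairL pairR ∧I (eliminate d) (eliminate e)
eliminate (∧E₁ d)    = lift₁ π₁ π₁C ∧E₁ (eliminate d)
eliminate (∧E₂ d)    = lift₁ π₂ π₂C ∧E₂ (eliminate d)
eliminate (∨I₁ d)    = lift₁ in₁ in₁C ∨I₁ (eliminate d)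
eliminate (∨I₂ d)    = lift₁ in₂ in₂C ∨I₂ (eliminate d)
eliminate (⊥E d)     = lift₁ efq efqC ⊥E (eliminate d)
eliminate (∨E d e f) with eliminate d | eliminate e | eliminate f
... | reduct a r da | reduct b r₁ db | reduct c r₂ dc =
  reduct (case a b c) (gmap _ caseC r ◅◅ gmap _ case₁C r₁ ◅◅ gmap _ case₂C r₂) (∨E da db dc)
eliminate (visser Bs Cs dt ds₁ ds₂ dus) with eliminate dt
... | reduct _ r₁ d₁ with normalise d₁
... | (t₀ , r₀ , nf₀ , d₀) =
  expand (gmap _ VtC (r₁ ◅◅ r₀))
    (fire Bs Cs nf₀ d₀ (eliminate ds₁) (eliminate ds₂) (λ j → eliminate (dus j)))

mainTheorem2 : (Γ : Ctx) (t : Tm) (A : Form) → Γ ⊢V t ∶ A →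
    Σ Tm (λ t' → IPCTerm t' × (t →V* t') × Normal t' × (Γ ⊢IPC t' ∶ A))
mainTheorem2 Γ t A d with eliminate d
... | reduct _ r₁ d₁ with normalise d₁
... | (t₀ , r₀ , nf₀ , d₀) = t₀ , nf-ipc nf₀ , r₁ ◅◅ r₀ , nf-normal nf₀ , d₀
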